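{- Let $N\ge 2$ be an integer and, for $n\ge 0$, let $\kappa_n$ be the coefficient of $x^{N-1}$ in the remainder of $(x^{N-1}+1)^n$ upon division by $x^N+x-1$ in $\mathbb{Q}[x]$. Then $\kappa_n=\kappa_{n-1}+\kappa_{n-N}$ for all $n\ge N$.
   Context: The remainder is the unique polynomial of degree at most $N-1$ congruent to $(x^{N-1}+1)^n$ modulo $x^N+x-1$; equivalently it is obtained by repeatedly replacing $x^N$ by $1-x$. -}

module Defs where

open import Data.Nat using (ℕ; zero; suc)
open import Data.Rational using (ℚ; 0ℚ; 1ℚ; _+_; _*_; -_)
open import Data.List using (List; []; _∷_; map; replicate; _++_)
open import Data.Product using (∃)
open import Relation.Binary.PropositionalEquality using (_≡_)

-- Polynomials in ℚ[x] as coefficient lists (constant term first).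
-- Trailing zeros are allowed; equality of polynomials is coefficientwise.
Poly : Set
Poly = List ℚ

coeff : Poly → ℕ → ℚ
coeff []       _       = 0ℚ
coeff (a ∷ p)  zero    = a
coeff (a ∷ p)  (suc i) = coeff p i

_+ₚ_ : Poly → Poly → Poly
[]      +ₚ q       = q
(a ∷ p) +ₚ []      = a ∷ p
(a ∷ p) +ₚ (b ∷ q) = (a + b) ∷ (p +ₚ q)

-ₚ_ : Poly → Poly
-ₚ p = map -_ p

_*ₚ_ : Poly → Poly → Poly
[]      *ₚ q = []
(a ∷ p) *ₚ q = map (a *_) q +ₚ (0ℚ ∷ (p *ₚ q))

_^ₚ_ : Poly → ℕ → Poly
p ^ₚ zero    = 1ℚ ∷ []
p ^ₚ (suc n) = p *ₚ (p ^ₚ n)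

X^ : ℕ → Poly
X^ k = replicate k 0ℚ ++ (1ℚ ∷ [])

_≈ₚ_ : Poly → Poly → Set
p ≈ₚ q = ∀ i → coeff p i ≡ coeff q i

_∣ₚ_ : Poly → Poly → Set
d ∣ₚ p = ∃ λ (q : Poly) → p ≈ₚ (q *ₚ d)

_≡_[modₚ_] : Poly → Poly → Poly → Set
p ≡ q [modₚ d ] = d ∣ₚ (p +ₚ (-ₚ q))

module Submission where

-- Pair a polynomial p with a rational sequence s by ⟨p, s⟩ = Σᵢ pᵢ sᵢ.
-- If s solves the linear recurrence s(k+N) = s(k) − s(k+1), i.e. s is
-- annihilated by f = x^N + x − 1 read as a shift operator, then ⟨Q·f, s⟩ = 0
-- for every Q, so ⟨−, s⟩ only depends on the class of a polynomial mod f.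
-- Taking for s = e the solution with initial values e(i) = [i = N−1] for
-- i < N, the pairing of e with a polynomial of degree < N is its coefficient
-- of x^(N−1); hence κₙ = ⟨yⁿ, e⟩ with y = x^(N−1) + 1.
-- Multiplication by y is adjoint to the operator Y = S^(N−1) + 1 on sequences
-- (S the shift), so κₙ = (Yⁿ e)(0).  On solutions of the recurrence Y inverts
-- S, whence Y^N = Y^(N−1) + 1 there, and the recurrence for κ follows.

open import Defs
open import Data.Nat using (ℕ; _≤_; _∸_; _+_)
open import Data.Vec using (Vec; toList)
open import Relation.Binary.PropositionalEquality using (_≡_)
open import Data.Rational using (ℚ) renaming (_+_ to _+ℚ_)

open import Data.Nat using (zero; suc; _<_; s≤s; z≤n)
open import Data.Nat.Properties
  using (m≤n⇒∃[o]m+o≡n; m+n∸m≡n; +-suc; +-comm; +-assoc; +-identityʳ; ≤-refl; <⇒≤; m<1+n⇒m≤n)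
open import Data.Nat.GeneralisedArithmetic using (iterate; fold)
open import Data.Nat.Tactic.RingSolver using (solve-∀)
open import Data.Rational using (0ℚ; 1ℚ; -_) renaming (_*_ to _*ℚ_)
open import Data.Rational.Properties using (+-0-group)
  renaming (+-identityˡ to +ℚ-identityˡ; +-identityʳ to +ℚ-identityʳ;
            *-zeroˡ to *ℚ-zeroˡ; *-zeroʳ to *ℚ-zeroʳ; *-identityˡ to *ℚ-identityˡ;
            *-identityʳ to *ℚ-identityʳ; +-comm to +ℚ-comm)
open import Data.Rational.Solver using (module +-*-Solver)
open +-*-Solver using (solve; _:+_; _:*_; :-_; _:=_; con)
open import Algebra.Properties.Group +-0-group using (x∙y⁻¹≈ε⇒x≈y)
open import Data.List using ([]; _∷_; map)
open import Data.Vec using ([]; _∷_)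
open import Data.Product using (_,_)
open import Relation.Binary.PropositionalEquality using (refl; sym; trans; cong; cong₂; module ≡-Reasoning)
open ≡-Reasoning

Seq : Set
Seq = ℕ → ℚ

_≐_ : Seq → Seq → Set
s ≐ t = ∀ i → s i ≡ t i

pair : Seq → Poly → ℚ
pair s []      = 0ℚ
pair s (a ∷ p) = a *ℚ s 0 +ℚ pair (λ i → s (suc i)) p

pair-ext : ∀ {s t} p → s ≐ t → pair s p ≡ pair t p
pair-ext []      s≐t = refl
pair-ext (a ∷ p) s≐t =
  cong₂ (λ x y → a *ℚ x +ℚ y) (s≐t 0) (pair-ext p (λ i → s≐t (suc i)))

pair-ext< : ∀ {k s t} (v : Vec ℚ k) → (∀ i → i < k → s i ≡ t i) →
            pair s (toList v) ≡ pair t (toList v)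
pair-ext< []      agree = refl
pair-ext< (a ∷ v) agree =
  cong₂ (λ x y → a *ℚ x +ℚ y) (agree 0 (s≤s z≤n)) (pair-ext< v (λ i i<k → agree (suc i) (s≤s i<k)))

pair-zeroₚ : ∀ s p → (∀ i → coeff p i ≡ 0ℚ) → pair s p ≡ 0ℚ
pair-zeroₚ s []      p≈0 = refl
pair-zeroₚ s (a ∷ p) p≈0 = begin
  a *ℚ s 0 +ℚ pair (λ i → s (suc i)) p  ≡⟨ cong₂ (λ x y → x *ℚ s 0 +ℚ y) (p≈0 0) (pair-zeroₚ _ p (λ i → p≈0 (suc i))) ⟩
  0ℚ *ℚ s 0 +ℚ 0ℚ                        ≡⟨ cong (_+ℚ 0ℚ) (*ℚ-zeroˡ (s 0)) ⟩
  0ℚ                                     ∎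

pair-≈ : ∀ s p q → p ≈ₚ q → pair s p ≡ pair s q
pair-≈ s []      q       p≈q = sym (pair-zeroₚ s q (λ i → sym (p≈q i)))
pair-≈ s (a ∷ p) []      p≈q = pair-zeroₚ s (a ∷ p) p≈q
pair-≈ s (a ∷ p) (b ∷ q) p≈q =
  cong₂ (λ x y → x *ℚ s 0 +ℚ y) (p≈q 0) (pair-≈ _ p q (λ i → p≈q (suc i)))

pair-+ₚ : ∀ s p q → pair s (p +ₚ q) ≡ pair s p +ℚ pair s q
pair-+ₚ s []      q       = sym (+ℚ-identityˡ (pair s q))
pair-+ₚ s (a ∷ p) []      = sym (+ℚ-identityʳ (pair s (a ∷ p)))
pair-+ₚ s (a ∷ p) (b ∷ q) = trans (cong ((a +ℚ b) *ℚ s 0 +ℚ_) (pair-+ₚ _ p q))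
  (solve 5 (λ a b x u v → (a :+ b) :* x :+ (u :+ v) := (a :* x :+ u) :+ (b :* x :+ v))
     refl a b (s 0) (pair _ p) (pair _ q))

pair--ₚ : ∀ s p → pair s (-ₚ p) ≡ - pair s p
pair--ₚ s []      = refl
pair--ₚ s (a ∷ p) = trans (cong ((- a) *ℚ s 0 +ℚ_) (pair--ₚ _ p))
  (solve 3 (λ a x u → (:- a) :* x :+ (:- u) := :- (a :* x :+ u)) refl a (s 0) (pair _ p))

pair-scaleₚ : ∀ s c q → pair s (map (c *ℚ_) q) ≡ c *ℚ pair s q
pair-scaleₚ s c []      = sym (*ℚ-zeroʳ c)
pair-scaleₚ s c (b ∷ q) = trans (cong ((c *ℚ b) *ℚ s 0 +ℚ_) (pair-scaleₚ _ c q))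
  (solve 4 (λ c b x u → (c :* b) :* x :+ c :* u := c :* (b :* x :+ u)) refl c b (s 0) (pair _ q))

pair-X^ : ∀ s k → pair s (X^ k) ≡ s k
pair-X^ s zero    = trans (+ℚ-identityʳ (1ℚ *ℚ s 0)) (*ℚ-identityˡ (s 0))
pair-X^ s (suc k) = begin
  0ℚ *ℚ s 0 +ℚ pair (λ i → s (suc i)) (X^ k)  ≡⟨ cong₂ _+ℚ_ (*ℚ-zeroˡ (s 0)) (pair-X^ _ k) ⟩
  0ℚ +ℚ s (suc k)                             ≡⟨ +ℚ-identityˡ (s (suc k)) ⟩
  s (suc k)                                   ∎

pair-zeroˢ : ∀ p → pair (λ _ → 0ℚ) p ≡ 0ℚ
pair-zeroˢ []      = refl
pair-zeroˢ (a ∷ p) = trans (cong₂ _+ℚ_ (*ℚ-zeroʳ a) (pair-zeroˢ p)) (+ℚ-identityˡ 0ℚ)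

pair-+ˢ : ∀ s t p → pair (λ i → s i +ℚ t i) p ≡ pair s p +ℚ pair t p
pair-+ˢ s t []      = sym (+ℚ-identityˡ 0ℚ)
pair-+ˢ s t (a ∷ p) = trans (cong (a *ℚ (s 0 +ℚ t 0) +ℚ_) (pair-+ˢ _ _ p))
  (solve 5 (λ a x y u v → a :* (x :+ y) :+ (u :+ v) := (a :* x :+ u) :+ (a :* y :+ v))
     refl a (s 0) (t 0) (pair _ p) (pair _ p))

pair--ˢ : ∀ s p → pair (λ i → - s i) p ≡ - pair s p
pair--ˢ s []      = refl
pair--ˢ s (a ∷ p) = trans (cong (a *ℚ (- s 0) +ℚ_) (pair--ˢ _ p))
  (solve 3 (λ a x u → a :* (:- x) :+ (:- u) := :- (a :* x :+ u)) refl a (s 0) (pair _ p))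

pair-scaleˢ : ∀ c s p → pair (λ i → c *ℚ s i) p ≡ c *ℚ pair s p
pair-scaleˢ c s []      = sym (*ℚ-zeroʳ c)
pair-scaleˢ c s (a ∷ p) = trans (cong (a *ℚ (c *ℚ s 0) +ℚ_) (pair-scaleˢ c _ p))
  (solve 4 (λ c a x u → a :* (c :* x) :+ c :* u := c :* (a :* x :+ u)) refl c a (s 0) (pair _ p))

-- The action of a polynomial g on sequences, g(S) with S the shift
-- (S s)(i) = s(i+1): (act g s)(j) = Σᵢ gᵢ s(i+j).  It is adjoint to
-- multiplication by g, which is what turns powers into iterates.
act : Poly → Seq → Seq
act g s j = pair (λ i → s (i + j)) g

pair-*ₚ : ∀ s p q → pair s (p *ₚ q) ≡ pair (act p s) q
pair-*ₚ s []      q = sym (pair-zeroˢ q)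
pair-*ₚ s (a ∷ p) q = begin
  pair s (map (a *ℚ_) q +ₚ (0ℚ ∷ (p *ₚ q)))
    ≡⟨ pair-+ₚ s (map (a *ℚ_) q) (0ℚ ∷ (p *ₚ q)) ⟩
  pair s (map (a *ℚ_) q) +ℚ (0ℚ *ℚ s 0 +ℚ pair (λ i → s (suc i)) (p *ₚ q))
    ≡⟨ cong₂ _+ℚ_ (pair-scaleₚ s a q) (cong₂ _+ℚ_ (*ℚ-zeroˡ (s 0)) (pair-*ₚ (λ i → s (suc i)) p q)) ⟩
  a *ℚ pair s q +ℚ (0ℚ +ℚ pair (act p (λ i → s (suc i))) q)
    ≡⟨ cong₂ _+ℚ_ (sym (pair-scaleˢ a s q)) (+ℚ-identityˡ _) ⟩
  pair (λ j → a *ℚ s j) q +ℚ pair (act p (λ i → s (suc i))) q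
    ≡⟨ sym (pair-+ˢ (λ j → a *ℚ s j) (act p (λ i → s (suc i))) q) ⟩
  pair (act (a ∷ p) s) q
    ∎

pair-^ₚ : ∀ g s n → pair s (g ^ₚ n) ≡ iterate (act g) s n 0
pair-^ₚ g s zero    = pair-X^ s 0
pair-^ₚ g s (suc n) = trans (pair-*ₚ s g (g ^ₚ n)) (pair-^ₚ g (act g s) n)

act-ext : ∀ g {s t} → s ≐ t → act g s ≐ act g t
act-ext g s≐t j = pair-ext g (λ i → s≐t (i + j))

act-+ : ∀ g s t → act g (λ i → s i +ℚ t i) ≐ (λ i → act g s i +ℚ act g t i)
act-+ g s t j = pair-+ˢ (λ i → s (i + j)) (λ i → t (i + j)) g

iterate-act-ext : ∀ g k {s t} → s ≐ t → iterate (act g) s k ≐ iterate (act g) t k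
iterate-act-ext g zero    s≐t = s≐t
iterate-act-ext g (suc k) s≐t = iterate-act-ext g k (act-ext g s≐t)

iterate-act-+ : ∀ g k s t →
  iterate (act g) (λ i → s i +ℚ t i) k ≐ (λ i → iterate (act g) s k i +ℚ iterate (act g) t k i)
iterate-act-+ g zero    s t i = refl
iterate-act-+ g (suc k) s t i =
  trans (iterate-act-ext g k (act-+ g s t) i) (iterate-act-+ g k (act g s) (act g t) i)

iterate-+ : ∀ {A : Set} (f : A → A) x a b → iterate f x (a + b) ≡ iterate f (iterate f x a) b
iterate-+ f x zero    b = refl
iterate-+ f x (suc a) b = iterate-+ f (f x) a b

modulus : ℕ → Poly
modulus N = X^ N +ₚ (X^ 1 +ₚ (-ₚ X^ 0))

base : ℕ → Poly
base N = X^ (N ∸ 1) +ₚ X^ 0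

Recurrent : ℕ → Seq → Set
Recurrent N s = ∀ k → s (k + N) ≡ s k +ℚ - s (suc k)

pair-modulus : ∀ N s → Recurrent N s → pair s (modulus N) ≡ 0ℚ
pair-modulus N s rec = begin
  pair s (modulus N)                  ≡⟨ pair-+ₚ s (X^ N) (X^ 1 +ₚ (-ₚ X^ 0)) ⟩
  pair s (X^ N) +ℚ pair s (X^ 1 +ₚ (-ₚ X^ 0))
    ≡⟨ cong₂ _+ℚ_ (pair-X^ s N) (pair-+ₚ s (X^ 1) (-ₚ X^ 0)) ⟩
  s N +ℚ (pair s (X^ 1) +ℚ pair s (-ₚ X^ 0))
    ≡⟨ cong₂ (λ x y → x +ℚ (pair s (X^ 1) +ℚ y)) (rec 0) (pair--ₚ s (X^ 0)) ⟩
  (s 0 +ℚ - s 1) +ℚ (pair s (X^ 1) +ℚ - pair s (X^ 0))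
    ≡⟨ cong₂ (λ x y → (s 0 +ℚ - s 1) +ℚ (x +ℚ - y)) (pair-X^ s 1) (pair-X^ s 0) ⟩
  (s 0 +ℚ - s 1) +ℚ (s 1 +ℚ - s 0)
    ≡⟨ solve 2 (λ x y → (x :+ :- y) :+ (y :+ :- x) := con 0ℚ) refl (s 0) (s 1) ⟩
  0ℚ  ∎

-- ... and the action of any polynomial preserves solutions, since it is
-- linear and commutes with the shift.
act-recurrent : ∀ N g s → Recurrent N s → Recurrent N (act g s)
act-recurrent N g s rec k = begin
  pair (λ i → s (i + (k + N))) g
    ≡⟨ pair-ext g (λ i → trans (cong s (sym (+-assoc i k N))) (rec (i + k))) ⟩
  pair (λ i → s (i + k) +ℚ - s (suc (i + k))) g
    ≡⟨ pair-+ˢ (λ i → s (i + k)) (λ i → - s (suc (i + k))) g ⟩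
  act g s k +ℚ pair (λ i → - s (suc (i + k))) g
    ≡⟨ cong (act g s k +ℚ_) (pair--ˢ (λ i → s (suc (i + k))) g) ⟩
  act g s k +ℚ - pair (λ i → s (suc (i + k))) g
    ≡⟨ cong (λ x → act g s k +ℚ - x) (pair-ext g (λ i → cong s (sym (+-suc i k)))) ⟩
  act g s k +ℚ - act g s (suc k)  ∎

pair-multiple : ∀ N s → Recurrent N s → ∀ Q → pair s (Q *ₚ modulus N) ≡ 0ℚ
pair-multiple N s rec Q =
  trans (pair-*ₚ s Q (modulus N)) (pair-modulus N (act Q s) (act-recurrent N Q s rec))

pair-cong : ∀ N s → Recurrent N s → ∀ p q → p ≡ q [modₚ modulus N ] → pair s p ≡ pair s q
pair-cong N s rec p q (Q , p-q≈Qf) = x∙y⁻¹≈ε⇒x≈y (pair s p) (pair s q) (begin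
  pair s p +ℚ - pair s q       ≡⟨ cong (pair s p +ℚ_) (sym (pair--ₚ s q)) ⟩
  pair s p +ℚ pair s (-ₚ q)    ≡⟨ sym (pair-+ₚ s p (-ₚ q)) ⟩
  pair s (p +ₚ (-ₚ q))         ≡⟨ pair-≈ s (p +ₚ (-ₚ q)) (Q *ₚ modulus N) p-q≈Qf ⟩
  pair s (Q *ₚ modulus N)      ≡⟨ pair-multiple N s rec Q ⟩
  0ℚ                           ∎)

act-base : ∀ M u j → act (base (suc M)) u j ≡ u (M + j) +ℚ u j
act-base M u j = begin
  act (base (suc M)) u j
    ≡⟨ pair-+ₚ (λ i → u (i + j)) (X^ M) (X^ 0) ⟩
  pair (λ i → u (i + j)) (X^ M) +ℚ pair (λ i → u (i + j)) (X^ 0)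
    ≡⟨ cong₂ _+ℚ_ (pair-X^ (λ i → u (i + j)) M) (pair-X^ (λ i → u (i + j)) 0) ⟩
  u (M + j) +ℚ u j  ∎

-- On solutions Y inverts the shift: Y(S u) = u, since u(N + j) + u(j + 1) = u(j).
base-undoes-shift : ∀ M u → Recurrent (suc M) u → ∀ k j →
  act (base (suc M)) (λ i → u (suc k + i)) j ≡ u (k + j)
base-undoes-shift M u rec k j = begin
  act (base (suc M)) (λ i → u (suc k + i)) j
    ≡⟨ act-base M (λ i → u (suc k + i)) j ⟩
  u (suc k + (M + j)) +ℚ u (suc (k + j))
    ≡⟨ cong (λ n → u n +ℚ u (suc (k + j))) (reindex k M j) ⟩
  u (k + j + suc M) +ℚ u (suc (k + j))
    ≡⟨ cong (_+ℚ u (suc (k + j))) (rec (k + j)) ⟩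
  (u (k + j) +ℚ - u (suc (k + j))) +ℚ u (suc (k + j))
    ≡⟨ solve 2 (λ x y → (x :+ :- y) :+ y := x) refl (u (k + j)) (u (suc (k + j))) ⟩
  u (k + j)  ∎
  where
  reindex : ∀ k M j → suc k + (M + j) ≡ k + j + suc M
  reindex = solve-∀

base-undoes-shifts : ∀ M u → Recurrent (suc M) u → ∀ k →
  iterate (act (base (suc M))) (λ i → u (k + i)) k ≐ u
base-undoes-shifts M u rec zero    i = refl
base-undoes-shifts M u rec (suc k) i =
  trans (iterate-act-ext (base (suc M)) k (base-undoes-shift M u rec k) i)
        (base-undoes-shifts M u rec k i)

-- The key identity Y^N = Y^(N−1) + 1 on solutions: Y^N u = Y^M (S^M u + u).
base-power : ∀ M u → Recurrent (suc M) u →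
  iterate (act (base (suc M))) u (suc M) ≐ (λ j → iterate (act (base (suc M))) u M j +ℚ u j)
base-power M u rec j = begin
  iterate Y (Y u) M j                                  ≡⟨ iterate-act-ext y M (act-base M u) j ⟩
  iterate Y (λ i → u (M + i) +ℚ u i) M j              ≡⟨ iterate-act-+ y M (λ i → u (M + i)) u j ⟩
  iterate Y (λ i → u (M + i)) M j +ℚ iterate Y u M j  ≡⟨ cong (_+ℚ iterate Y u M j) (base-undoes-shifts M u rec M j) ⟩
  u j +ℚ iterate Y u M j                              ≡⟨ +ℚ-comm (u j) (iterate Y u M j) ⟩
  iterate Y u M j +ℚ u j                              ∎
  where
  y = base (suc M)
  Y = act y

iterate-recurrence : ∀ M u → Recurrent (suc M) u → ∀ k →
  let c = λ n → iterate (act (base (suc M))) u n 0 in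
  c (suc M + k) ≡ c (M + k) +ℚ c k
iterate-recurrence M u rec k = begin
  iterate Y u (suc M + k) 0                            ≡⟨ cong (λ g → g 0) (iterate-+ Y u (suc M) k) ⟩
  iterate Y (iterate Y u (suc M)) k 0                  ≡⟨ iterate-act-ext y k (base-power M u rec) 0 ⟩
  iterate Y (λ j → iterate Y u M j +ℚ u j) k 0        ≡⟨ iterate-act-+ y k (iterate Y u M) u 0 ⟩
  iterate Y (iterate Y u M) k 0 +ℚ iterate Y u k 0    ≡⟨ cong (λ g → g 0 +ℚ iterate Y u k 0) (sym (iterate-+ Y u M k)) ⟩
  iterate Y u (M + k) 0 +ℚ iterate Y u k 0            ∎
  where
  y = base (suc M)
  Y = act y

-- Constructing solutions with prescribed initial values (N = M + 1 ≥ 2).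
-- A window w holds N consecutive values in positions 0..M; one step of the
-- recurrence drops w(0) and appends w(0) − w(1) at position M.
push : ℕ → ℚ → Seq → Seq
push zero    x w j       = x
push (suc M) x w zero    = w 1
push (suc M) x w (suc j) = push M x (λ i → w (suc i)) j

push-below : ∀ M x w j → j < M → push M x w j ≡ w (suc j)
push-below (suc M) x w zero    _         = refl
push-below (suc M) x w (suc j) (s≤s j<M) = push-below M x (λ i → w (suc i)) j j<M

push-at : ∀ M x w → push M x w M ≡ x
push-at zero    x w = refl
push-at (suc M) x w = push-at M x (λ i → w (suc i))

advance : ℕ → Seq → Seq
advance M w = push M (w 0 +ℚ - w 1) w

-- window M init k holds the values k, …, k + M of the solution; position 0
-- of the windows is the solution itself.
window : ℕ → Seq → ℕ → Seq
window M init k = fold init (advance M) k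

extend : ℕ → Seq → Seq
extend M init k = window M init k 0

window-shift : ∀ M init j → j ≤ M → ∀ k → window M init (k + j) 0 ≡ window M init k j
window-shift M init zero    _    k = cong (λ n → window M init n 0) (+-identityʳ k)
window-shift M init (suc j) j<M k = begin
  window M init (k + suc j) 0  ≡⟨ cong (λ n → window M init n 0) (+-suc k j) ⟩
  window M init (suc k + j) 0  ≡⟨ window-shift M init j (<⇒≤ j<M) (suc k) ⟩
  window M init (suc k) j      ≡⟨ push-below M _ (window M init k) j j<M ⟩
  window M init k (suc j)      ∎

extend-initial : ∀ M init i → i ≤ M → extend M init i ≡ init i
extend-initial M init i i≤M = window-shift M init i i≤M 0

extend-recurrent : ∀ K init → Recurrent (suc (suc K)) (extend (suc K) init)
extend-recurrent K init k = begin
  window M init (k + suc M) 0          ≡⟨ cong (λ n → window M init n 0) (+-suc k M) ⟩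
  window M init (suc k + M) 0          ≡⟨ window-shift M init M ≤-refl (suc k) ⟩
  push M (w 0 +ℚ - w 1) w M            ≡⟨ push-at M _ w ⟩
  w 0 +ℚ - w 1                         ≡⟨ cong (λ x → w 0 +ℚ - x) (sym (window-shift M init 1 (s≤s z≤n) k)) ⟩
  w 0 +ℚ - window M init (k + 1) 0     ≡⟨ cong (λ n → w 0 +ℚ - window M init n 0) (+-comm k 1) ⟩
  extend M init k +ℚ - extend M init (suc k) ∎
  where
  M = suc K
  w = window M init k

unit : ℕ → Seq
unit zero    zero    = 1ℚ
unit zero    (suc i) = 0ℚ
unit (suc m) zero    = 0ℚ
unit (suc m) (suc i) = unit m i

pair-unit : ∀ m p → pair (unit m) p ≡ coeff p m
pair-unit m       []      = refl
pair-unit zero    (a ∷ p) = begin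
  a *ℚ 1ℚ +ℚ pair (λ _ → 0ℚ) p  ≡⟨ cong₂ _+ℚ_ (*ℚ-identityʳ a) (pair-zeroˢ p) ⟩
  a +ℚ 0ℚ                       ≡⟨ +ℚ-identityʳ a ⟩
  a                             ∎
pair-unit (suc m) (a ∷ p) = begin
  a *ℚ 0ℚ +ℚ pair (unit m) p    ≡⟨ cong₂ _+ℚ_ (*ℚ-zeroʳ a) (pair-unit m p) ⟩
  0ℚ +ℚ coeff p m               ≡⟨ +ℚ-identityˡ (coeff p m) ⟩
  coeff p m                     ∎

remainder-coeff : ∀ K m (v : Vec ℚ (suc (suc K))) p → toList v ≡ p [modₚ modulus (suc (suc K)) ] →
  coeff (toList v) m ≡ pair (extend (suc K) (unit m)) p
remainder-coeff K m v p v≡p = begin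
  coeff (toList v) m              ≡⟨ sym (pair-unit m (toList v)) ⟩
  pair (unit m) (toList v)        ≡⟨ pair-ext< v (λ i i<N → sym (extend-initial (suc K) (unit m) i (m<1+n⇒m≤n i<N))) ⟩
  pair e (toList v)               ≡⟨ pair-cong (suc (suc K)) e (extend-recurrent K (unit m)) (toList v) p v≡p ⟩
  pair e p                        ∎
  where
  e = extend (suc K) (unit m)

mainTheorem2 : (N : ℕ) → 2 ≤ N → (r : ℕ → Vec ℚ N) →
    (∀ n → toList (r n) ≡ ((X^ (N ∸ 1) +ₚ X^ 0) ^ₚ n) [modₚ (X^ N +ₚ (X^ 1 +ₚ (-ₚ X^ 0))) ]) →
    ∀ n → N ≤ n →
    coeff (toList (r n)) (N ∸ 1)
    ≡ coeff (toList (r (n ∸ 1))) (N ∸ 1) +ℚ coeff (toList (r (n ∸ N))) (N ∸ 1)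
mainTheorem2 (suc zero)      (s≤s ()) r rem n N≤n
mainTheorem2 N@(suc (suc K)) _        r rem n N≤n with m≤n⇒∃[o]m+o≡n N≤n
... | k , refl = begin
  κ (N + k)                  ≡⟨ κ≡c (N + k) ⟩
  c (N + k)                  ≡⟨ iterate-recurrence M e (extend-recurrent K (unit M)) k ⟩
  c (M + k) +ℚ c k           ≡⟨ sym (cong₂ _+ℚ_ (κ≡c (M + k)) (trans (cong κ (m+n∸m≡n N k)) (κ≡c k))) ⟩
  κ (M + k) +ℚ κ (N + k ∸ N) ∎
  where
  M = suc K
  e = extend M (unit M)
  κ : ℕ → ℚ
  κ m = coeff (toList (r m)) M
  c : ℕ → ℚ
  c m = iterate (act (base N)) e m 0
  κ≡c : ∀ m → κ m ≡ c m
  κ≡c m = trans (remainder-coeff K M (r m) (base N ^ₚ m) (rem m)) (pair-^ₚ (base N) e m)
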